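{- Let $G$ be a finite, simple, undirected, connected graph on $n\geq 3$ vertices which has no induced $C_4$, has no pair of false-twin vertices, has no vertex of degree one, and such that the set $\mathcal{A}$ of alone vertices of $G$ has a good assignment. Then $G$ has at least $n$ bicliques.
   Context: All graphs are finite, simple, undirected and connected (standing assumption of the paper). A biclique of $G$ is a maximal (with respect to vertex-set inclusion) induced subgraph of $G$ that is a complete bipartite graph $K_{p,q}$ with $p,q\geq 1$; bicliques are counted as distinct vertex sets. $N(v)$ is the open neighborhood and $N[v]=N(v)\cup\{v\}$ the closed neighborhood. Two distinct vertices $u,v$ are false-twins if $N(u)=N(v)$ and true-twins if $N[u]=N[v]$. A vertex $v$ is dominated by a vertex $v'$ if $N[v]\subseteq N[v']$. A vertex $v$ is simplicial if $\{v\}\cup N(v)$ is a clique. A vertex $x$ is alone if $x$ is simplicial and no vertex of $N(x)$ is simplicial; $\mathcal{A}$ denotes the set of alone vertices. An assignment for $\mathcal{A}$ associates to each alone vertex $x$ a vertex $v$ and an edge $vv'$ with $v,v'\in N(x)$, such that either $v$ is not dominated by $v'$ or $v$ and $v'$ are true-twins. The assignment is good if whenever two different alone vertices have the same associated edge, the endpoints of that edge are not true-twins and the vertices associated to the two alone vertices are different. $\mathcal{A}$ has a good assignment if some good assignment for $\mathcal{A}$ exists. -}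

module Defs where

open import Data.Nat using (ℕ)
open import Data.Fin using (Fin)
open import Data.Fin.Subset using (Subset; _∈_; _∉_; _⊆_; Nonempty)
open import Data.List using (allFin; filter; length)
open import Data.Product using (Σ; ∃; ∃-syntax; _×_; _,_; proj₁; proj₂)
open import Data.Sum using (_⊎_)
open import Data.Empty using (⊥)
open import Relation.Nullary using (¬_; Dec)
open import Relation.Binary.PropositionalEquality using (_≡_; _≢_)
open import Function.Bundles using (_⇔_)

record Graph (n : ℕ) : Set₁ where
  field
    E       : Fin n → Fin n → Set
    E-sym   : ∀ {u v} → E u v → E v u
    E-irr   : ∀ {u} → ¬ E u u
    E-dec   : ∀ u v → Dec (E u v)

module _ {n : ℕ} (G : Graph n) where
  open Graph G

  data Reach : Fin n → Fin n → Set where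
    here : ∀ {u} → Reach u u
    step : ∀ {u w v} → E u w → Reach w v → Reach u v

  Connected : Set
  Connected = ∀ u v → Reach u v

  degree : Fin n → ℕ
  degree v = length (filter (E-dec v) (allFin n))

  InClosedN : Fin n → Fin n → Set
  InClosedN v w = w ≡ v ⊎ E v w

  FalseTwins : Fin n → Fin n → Set
  FalseTwins u v = u ≢ v × (∀ w → E u w ⇔ E v w)

  TrueTwins : Fin n → Fin n → Set
  TrueTwins u v = u ≢ v × (∀ w → InClosedN u w ⇔ InClosedN v w)

  DominatedBy : Fin n → Fin n → Set
  DominatedBy v v' = ∀ w → InClosedN v w → InClosedN v' w

  Simplicial : Fin n → Set
  Simplicial v = ∀ u w → InClosedN v u → InClosedN v w → u ≢ w → E u w

  Alone : Fin n → Set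
  Alone x = Simplicial x × (∀ u → E x u → ¬ Simplicial u)

  HasInducedC4 : Set
  HasInducedC4 = ∃[ a ] ∃[ b ] ∃[ c ] ∃[ d ]
    (a ≢ b × a ≢ c × a ≢ d × b ≢ c × b ≢ d × c ≢ d ×
     E a b × E b c × E c d × E d a × ¬ E a c × ¬ E b d)

  SameEdge : Fin n × Fin n → Fin n × Fin n → Set
  SameEdge (v , v') (w , w') = (v ≡ w × v' ≡ w') ⊎ (v ≡ w' × v' ≡ w)

  -- An assignment: to each vertex x a pair (v , v'), meaning the vertex v
  -- and the edge vv'; only its values on alone vertices matter.
  ValidAt : Fin n → Fin n × Fin n → Set
  ValidAt x (v , v') =
    E x v × E x v' × E v v' × (¬ DominatedBy v v' ⊎ TrueTwins v v')

  IsAssignment : (Fin n → Fin n × Fin n) → Set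
  IsAssignment f = ∀ x → Alone x → ValidAt x (f x)

  IsGood : (Fin n → Fin n × Fin n) → Set
  IsGood f = ∀ x y → Alone x → Alone y → x ≢ y → SameEdge (f x) (f y) →
    ¬ TrueTwins (proj₁ (f x)) (proj₂ (f x)) × proj₁ (f x) ≢ proj₁ (f y)

  HasGoodAssignment : Set
  HasGoodAssignment = ∃[ f ] (IsAssignment f × IsGood f)

  IsInducedCompleteBipartite : Subset n → Set
  IsInducedCompleteBipartite S = ∃[ A ] ∃[ B ]
    ( (∀ i → i ∈ S ⇔ (i ∈ A ⊎ i ∈ B))
    × (∀ i → i ∈ A → i ∉ B)
    × Nonempty A × Nonempty B
    × (∀ a a' → a ∈ A → a' ∈ A → ¬ E a a')
    × (∀ b b' → b ∈ B → b' ∈ B → ¬ E b b')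
    × (∀ a b → a ∈ A → b ∈ B → E a b))

  IsBiclique : Subset n → Set
  IsBiclique S = IsInducedCompleteBipartite S
    × (∀ S' → S ⊆ S' → IsInducedCompleteBipartite S' → S' ⊆ S)

  AtLeastBicliques : ℕ → Set
  AtLeastBicliques k = Σ (Fin k → Subset n) λ β →
    (∀ i → IsBiclique (β i)) × (∀ i j → β i ≡ β j → i ≡ j)

-- Each vertex is assigned a biclique of its own. Most of them are stars: a centre c with a maximal
-- independent set L of neighbours of c, grown greedily from a seed. As G has no induced C4 and L has
-- two nonadjacent leaves, every common neighbour of L lies in N[c], so the star is a maximal
-- biclique; the other bicliques are edges between true twins. A non-simplicial vertex centres its
-- own star; a simplicial vertex with a smaller simplicial neighbour w takes the edge to w; the least
-- vertex of a clique of simplicial vertices takes a star centred at a non-simplicial neighbour; an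
-- alone vertex uses its assigned vertex v and edge vv'. Equal stars share their centre, and the
-- seeds make two vertices claiming the same star put adjacent vertices among its leaves, except for
-- two alone vertices with the same assigned vertex and edge, which a good assignment forbids.
-- A graph without non-simplicial vertices is complete and is handled by the edges 12 and 0u.

module Submission where

open import Defs
open import Data.Nat using (ℕ; _+_; _≥_; s≤s; z≤n)
open import Relation.Binary.PropositionalEquality using (_≢_; _≡_; refl; sym; trans; subst)
open import Data.Fin using (Fin; zero; suc; _<_)
open import Data.Fin.Properties using (any?; all?; ¬∀⟶∃¬; _≟_; _<?_; <-cmp; <-asym)
open import Data.Fin.Subset using (Subset; _∈_; _∉_; _⊆_; Nonempty; ⁅_⁆; _∪_)
open import Data.Fin.Subset.Properties using (_∈?_; x∈⁅x⁆; x∈⁅y⁆⇒x≡y; x∈p∪q⁺; x∈p∪q⁻; ∪⇔⊎; ⊆-refl; ⊆-reflexive)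
open import Data.Bool using (true)
open import Data.Unit using (⊤; tt)
open import Data.Vec using (tabulate)
open import Data.Vec.Properties using (lookup∘tabulate; []=⇒lookup; lookup⇒[]=)
open import Data.List using (List; []; _∷_; allFin)
open import Data.List.Membership.Propositional using () renaming (_∈_ to _∈ˡ_)
open import Data.List.Membership.Propositional.Properties using (∈-allFin)
open import Data.List.Relation.Unary.Any using (here; there)
open import Data.Product using (∃-syntax; _×_; _,_; proj₁; proj₂)
open import Data.Sum using (_⊎_; inj₁; inj₂) renaming (swap to ⊎-swap)
open import Data.Empty using (⊥; ⊥-elim)
open import Level using (0ℓ)
open import Relation.Unary using (Pred; Decidable)
open import Relation.Nullary using (¬_; Dec; yes; no; does)
open import Relation.Nullary.Decidable using (_×-dec_; _⊎-dec_; _→-dec_; ¬?; dec-true; decidable-stable)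
open import Relation.Binary.Definitions using (tri<; tri≈; tri>)
open import Function.Bundles using (mk⇔; Equivalence)

module _ {n : ℕ} {P : Pred (Fin n) 0ℓ} (P? : Decidable P) where

  toSubset : Subset n
  toSubset = tabulate (λ k → does (P? k))

  ∈-toSubset⁺ : ∀ {k} → P k → k ∈ toSubset
  ∈-toSubset⁺ {k} p = lookup⇒[]= k toSubset (trans (lookup∘tabulate _ k) (dec-true (P? k) p))

  ∈-toSubset⁻ : ∀ {k} → k ∈ toSubset → P k
  ∈-toSubset⁻ {k} k∈ = decided (P? k) (trans (sym (lookup∘tabulate _ k)) ([]=⇒lookup k∈))
    where
      decided : (d : Dec (P k)) → does d ≡ true → P k
      decided (yes p) _  = p
      decided (no _)  ()

three-distinct-in-pair : ∀ {A : Set} {x y z p q : A} → x ≢ y → x ≢ z → y ≢ z →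
  x ≡ p ⊎ x ≡ q → y ≡ p ⊎ y ≡ q → z ≡ p ⊎ z ≡ q → ⊥
three-distinct-in-pair x≢y x≢z y≢z (inj₁ refl) (inj₁ refl) _           = x≢y refl
three-distinct-in-pair x≢y x≢z y≢z (inj₂ refl) (inj₂ refl) _           = x≢y refl
three-distinct-in-pair x≢y x≢z y≢z (inj₁ refl) (inj₂ refl) (inj₁ refl) = x≢z refl
three-distinct-in-pair x≢y x≢z y≢z (inj₁ refl) (inj₂ refl) (inj₂ refl) = y≢z refl
three-distinct-in-pair x≢y x≢z y≢z (inj₂ refl) (inj₁ refl) (inj₁ refl) = y≢z refl
three-distinct-in-pair x≢y x≢z y≢z (inj₂ refl) (inj₁ refl) (inj₂ refl) = x≢z refl

HasTwoElements : ∀ {n} → Subset n → Set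
HasTwoElements L = ∃[ a ] ∃[ b ] (a ∈ L × b ∈ L × a ≢ b)

module _ {n : ℕ} (G : Graph n) where
  open Graph G

  adjacent⇒≢ : ∀ {u v} → E u v → u ≢ v
  adjacent⇒≢ e refl = E-irr e

  inClosedN? : ∀ v w → Dec (InClosedN G v w)
  inClosedN? v w = (w ≟ v) ⊎-dec E-dec v w

  simplicial? : ∀ v → Dec (Simplicial G v)
  simplicial? v = all? λ p → all? λ q →
    inClosedN? v p →-dec (inClosedN? v q →-dec (¬? (p ≟ q) →-dec E-dec p q))

  simplicial-adjacent : ∀ {s p q} → Simplicial G s → E s p → E s q → p ≢ q → E p q
  simplicial-adjacent ss sp sq = ss _ _ (inj₂ sp) (inj₂ sq)

  neighbourhood-clique⇒simplicial : ∀ {z} → (∀ {p q} → E z p → E z q → p ≢ q → E p q) → Simplicial G z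
  neighbourhood-clique⇒simplicial clique p q (inj₁ refl) (inj₁ refl) p≢q = ⊥-elim (p≢q refl)
  neighbourhood-clique⇒simplicial clique p q (inj₁ refl) (inj₂ zq)  _   = zq
  neighbourhood-clique⇒simplicial clique p q (inj₂ zp)  (inj₁ refl) _   = E-sym zp
  neighbourhood-clique⇒simplicial clique p q (inj₂ zp)  (inj₂ zq)  p≢q = clique zp zq p≢q

  dominated⇒simplicial : ∀ {v v'} → DominatedBy G v v' → Simplicial G v' → Simplicial G v
  dominated⇒simplicial dom sv' p q vp vq = sv' p q (dom p vp) (dom q vq)

  simplicial⇒dominated : ∀ {p q} → Simplicial G p → E p q → DominatedBy G p q
  simplicial⇒dominated sp pq w (inj₁ refl) = inj₂ (E-sym pq)
  simplicial⇒dominated {q = q} sp pq w (inj₂ pw) with w ≟ q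
  ... | yes w≡q = inj₁ w≡q
  ... | no  w≢q = inj₂ (simplicial-adjacent sp pq pw (λ q≡w → w≢q (sym q≡w)))

  nonSimplicial⇒nonadjacent-neighbours : ∀ {z} → ¬ Simplicial G z →
    ∃[ a ] ∃[ b ] (E z a × E z b × ¬ InClosedN G a b)
  nonSimplicial⇒nonadjacent-neighbours {z} ns
    with any? (λ a → any? (λ b → E-dec z a ×-dec E-dec z b ×-dec ¬? (inClosedN? a b)))
  ... | yes found = found
  ... | no none = ⊥-elim (ns (neighbourhood-clique⇒simplicial clique))
    where
      clique : ∀ {p q} → E z p → E z q → p ≢ q → E p q
      clique {p} {q} zp zq p≢q
        with decidable-stable (inClosedN? p q) (λ q∉ → none (p , q , zp , zq , q∉))
      ... | inj₁ q≡p = ⊥-elim (p≢q (sym q≡p))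
      ... | inj₂ pq  = pq

  ¬dominated⇒private-neighbour : ∀ {v v'} → E v v' → ¬ DominatedBy G v v' →
    ∃[ w ] (E v w × ¬ InClosedN G v' w)
  ¬dominated⇒private-neighbour {v} {v'} vv' nd
    with ¬∀⟶∃¬ n _ (λ w → inClosedN? v w →-dec inClosedN? v' w) nd
  ... | w , ¬dom with inClosedN? v w
  ...   | no  w∉      = ⊥-elim (¬dom (λ w∈ → ⊥-elim (w∉ w∈)))
  ...   | yes (inj₁ refl) = ⊥-elim (¬dom (λ _ → inj₂ (E-sym vv')))
  ...   | yes (inj₂ vw) = w , vw , (λ w∈ → ¬dom (λ _ → w∈))

  trueTwins⇒adjacent : ∀ {p q} → TrueTwins G p q → E p q
  trueTwins⇒adjacent (p≢q , twins) with Equivalence.to (twins _) (inj₁ refl)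
  ... | inj₁ p≡q = ⊥-elim (p≢q p≡q)
  ... | inj₂ qp  = E-sym qp

  adjacent-simplicial⇒trueTwins : ∀ {p q} → Simplicial G p → Simplicial G q → E p q → TrueTwins G p q
  adjacent-simplicial⇒trueTwins sp sq pq =
    adjacent⇒≢ pq ,
    λ w → mk⇔ (simplicial⇒dominated sp pq w) (simplicial⇒dominated sq (E-sym pq) w)

  -- When all neighbours of u are simplicial, N[u] is closed under adjacency.
  neighbourhood-spans : Connected G → ∀ {u} → (∀ {w} → E u w → Simplicial G w) → ∀ v → InClosedN G u v
  neighbourhood-spans connected {u} nbrs-simplicial v = along (connected u v) (inj₁ refl)
    where
      along : ∀ {w v} → Reach G w v → InClosedN G u w → InClosedN G u v
      along here w∈ = w∈
      along (step {w = w'} ww' walk) (inj₁ refl) = along walk (inj₂ ww')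
      along (step {w = w'} ww' walk) (inj₂ uw) with w' ≟ u
      ... | yes w'≡u = along walk (inj₁ w'≡u)
      ... | no  w'≢u = along walk
            (inj₂ (simplicial-adjacent (nbrs-simplicial uw) (E-sym uw) ww' (λ u≡w' → w'≢u (sym u≡w'))))

  inducedC4 : ∀ {a b c d} → a ≢ c → b ≢ d → E a b → E b c → E c d → E d a →
    ¬ E a c → ¬ E b d → HasInducedC4 G
  inducedC4 a≢c b≢d ab bc cd da ¬ac ¬bd =
    _ , _ , _ , _ ,
    adjacent⇒≢ ab , a≢c , (λ a≡d → adjacent⇒≢ da (sym a≡d)) , adjacent⇒≢ bc , b≢d , adjacent⇒≢ cd ,
    ab , bc , cd , da , ¬ac , ¬bd

  common-neighbours-adjacent : ¬ HasInducedC4 G → ∀ {a b z w} → a ≢ b → ¬ E a b →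
    E z a → E z b → E w a → E w b → z ≢ w → E z w
  common-neighbours-adjacent noC4 {a} {b} {z} {w} a≢b ¬ab za zb wa wb z≢w with E-dec z w
  ... | yes zw = zw
  ... | no ¬zw = ⊥-elim (noC4 (inducedC4 z≢w a≢b za (E-sym wa) wb (E-sym zb) ¬zw ¬ab))

  -- A representative is the least vertex of its clique of mutually adjacent simplicial vertices.
  HasSmallerSimplicialNeighbour : Fin n → Set
  HasSmallerSimplicialNeighbour x = ∃[ w ] (E x w × Simplicial G w × w < x)

  Representative : Fin n → Set
  Representative x = Simplicial G x × ¬ HasSmallerSimplicialNeighbour x

  hasSmallerSimplicialNeighbour? : ∀ x → Dec (HasSmallerSimplicialNeighbour x)
  hasSmallerSimplicialNeighbour? x = any? λ w → E-dec x w ×-dec simplicial? w ×-dec (w <? x)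

  representative? : ∀ x → Dec (Representative x)
  representative? x = simplicial? x ×-dec ¬? (hasSmallerSimplicialNeighbour? x)

  representatives-nonadjacent : ∀ {x y} → Representative x → Representative y → ¬ E x y
  representatives-nonadjacent {x} {y} (sx , minx) (sy , miny) xy with <-cmp x y
  ... | tri< x<y _ _ = miny (x , E-sym xy , sx , x<y)
  ... | tri≈ _ x≡y _ = adjacent⇒≢ xy x≡y
  ... | tri> _ _ y<x = minx (y , xy , sy , y<x)

  alone⇒representative : ∀ {x} → Alone G x → Representative x
  alone⇒representative (sx , nbrs) = sx , λ (w , xw , sw , _) → nbrs w xw sw

  Independent : Subset n → Set
  Independent S = ∀ {k l} → k ∈ S → l ∈ S → ¬ E k l

  AdjacentToAll : Fin n → Subset n → Set
  AdjacentToAll z S = ∀ {k} → k ∈ S → E z k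

  IndependentNeighbours : Fin n → Subset n → Set
  IndependentNeighbours z S = AdjacentToAll z S × Independent S

  DominatesNeighbourhood : Fin n → Subset n → Set
  DominatesNeighbourhood z S = ∀ {w} → E z w → w ∈ S ⊎ ∃[ j ] (j ∈ S × E w j)

  toSubset-independentNeighbours : ∀ {z} {P : Pred (Fin n) 0ℓ} (P? : Decidable P) →
    (∀ {k} → P k → E z k) → (∀ {k l} → P k → P l → ¬ E k l) → IndependentNeighbours z (toSubset P?)
  toSubset-independentNeighbours P? adj ind =
    (λ k∈ → adj (∈-toSubset⁻ P? k∈)) , (λ k∈ l∈ → ind (∈-toSubset⁻ P? k∈) (∈-toSubset⁻ P? l∈))

  singleton-independent : ∀ {q} → Independent ⁅ q ⁆
  singleton-independent {q} k∈ l∈ with x∈⁅y⁆⇒x≡y q k∈ | x∈⁅y⁆⇒x≡y q l∈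
  ... | refl | refl = E-irr

  extendBy : Fin n → Fin n → Subset n → Subset n
  extendBy z i S with E-dec z i | any? (λ j → j ∈? S ×-dec E-dec i j)
  ... | yes _ | no _ = ⁅ i ⁆ ∪ S
  ... | _     | _    = S

  ⊆-extendBy : ∀ z i S → S ⊆ extendBy z i S
  ⊆-extendBy z i S with E-dec z i | any? (λ j → j ∈? S ×-dec E-dec i j)
  ... | yes _ | no  _ = λ k∈ → x∈p∪q⁺ (inj₂ k∈)
  ... | yes _ | yes _ = ⊆-refl
  ... | no  _ | _     = ⊆-refl

  extendBy-independentNeighbours : ∀ z i S → IndependentNeighbours z S → IndependentNeighbours z (extendBy z i S)
  extendBy-independentNeighbours z i S (adj , ind) with E-dec z i | any? (λ j → j ∈? S ×-dec E-dec i j)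
  ... | yes zi | no free = adj' , ind'
    where
      cases : ∀ {k} → k ∈ ⁅ i ⁆ ∪ S → k ≡ i ⊎ k ∈ S
      cases k∈ with x∈p∪q⁻ ⁅ i ⁆ S k∈
      ... | inj₁ k∈i = inj₁ (x∈⁅y⁆⇒x≡y i k∈i)
      ... | inj₂ k∈S = inj₂ k∈S
      adj' : AdjacentToAll z (⁅ i ⁆ ∪ S)
      adj' k∈ with cases k∈
      ... | inj₁ refl = zi
      ... | inj₂ k∈S = adj k∈S
      ind' : Independent (⁅ i ⁆ ∪ S)
      ind' k∈ l∈ with cases k∈ | cases l∈
      ... | inj₁ refl | inj₁ refl = E-irr
      ... | inj₁ refl | inj₂ l∈S  = λ il → free (_ , l∈S , il)
      ... | inj₂ k∈S  | inj₁ refl = λ ki → free (_ , k∈S , E-sym ki)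
      ... | inj₂ k∈S  | inj₂ l∈S  = ind k∈S l∈S
  ... | yes _ | yes _ = adj , ind
  ... | no  _ | _     = adj , ind

  extendBy-settles : ∀ z i S → E z i → i ∈ extendBy z i S ⊎ ∃[ j ] (j ∈ S × E i j)
  extendBy-settles z i S zi with E-dec z i | any? (λ j → j ∈? S ×-dec E-dec i j)
  ... | yes _  | no  _        = inj₁ (x∈p∪q⁺ (inj₁ (x∈⁅x⁆ i)))
  ... | yes _  | yes conflict = inj₂ conflict
  ... | no ¬zi | _            = ⊥-elim (¬zi zi)

  extendByAll : Fin n → List (Fin n) → Subset n → Subset n
  extendByAll z []       S = S
  extendByAll z (i ∷ is) S = extendByAll z is (extendBy z i S)

  ⊆-extendByAll : ∀ z is S → S ⊆ extendByAll z is S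
  ⊆-extendByAll z []       S = ⊆-refl
  ⊆-extendByAll z (i ∷ is) S = λ k∈ → ⊆-extendByAll z is _ (⊆-extendBy z i S k∈)

  extendByAll-independentNeighbours : ∀ z is S → IndependentNeighbours z S →
    IndependentNeighbours z (extendByAll z is S)
  extendByAll-independentNeighbours z []       S ok = ok
  extendByAll-independentNeighbours z (i ∷ is) S ok =
    extendByAll-independentNeighbours z is _ (extendBy-independentNeighbours z i S ok)

  extendByAll-dominates : ∀ z is S {w} → w ∈ˡ is → E z w →
    w ∈ extendByAll z is S ⊎ ∃[ j ] (j ∈ extendByAll z is S × E w j)
  extendByAll-dominates z (i ∷ is) S (here refl) zi with extendBy-settles z i S zi
  ... | inj₁ i∈         = inj₁ (⊆-extendByAll z is _ i∈)
  ... | inj₂ (j , j∈ , ij) = inj₂ (j , ⊆-extendByAll z is _ (⊆-extendBy z i S j∈) , ij)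
  extendByAll-dominates z (i ∷ is) S (there w∈) zw = extendByAll-dominates z is _ w∈ zw

  maximalExtension : Fin n → Subset n → Subset n
  maximalExtension z = extendByAll z (allFin n)

  maximalExtension-dominates : ∀ z S → DominatesNeighbourhood z (maximalExtension z S)
  maximalExtension-dominates z S = extendByAll-dominates z (allFin n) S (∈-allFin _)

  star : Fin n → Subset n → Subset n
  star z L = ⁅ z ⁆ ∪ L

  edge : Fin n × Fin n → Subset n
  edge (p , q) = star p ⁅ q ⁆

  centre∈star : ∀ z L → z ∈ star z L
  centre∈star z L = x∈p∪q⁺ (inj₁ (x∈⁅x⁆ z))

  leaf∈star : ∀ z {L k} → k ∈ L → k ∈ star z L
  leaf∈star z k∈ = x∈p∪q⁺ (inj₂ k∈)

  ∈-star⁻ : ∀ z L {k} → k ∈ star z L → k ≡ z ⊎ k ∈ L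
  ∈-star⁻ z L k∈ with x∈p∪q⁻ ⁅ z ⁆ L k∈
  ... | inj₁ k∈z = inj₁ (x∈⁅y⁆⇒x≡y z k∈z)
  ... | inj₂ k∈L = inj₂ k∈L

  ∈-edge⁻ : ∀ p q {k} → k ∈ edge (p , q) → k ≡ p ⊎ k ≡ q
  ∈-edge⁻ p q k∈ with ∈-star⁻ p ⁅ q ⁆ k∈
  ... | inj₁ k≡p  = inj₁ k≡p
  ... | inj₂ k∈q = inj₂ (x∈⁅y⁆⇒x≡y q k∈q)

  -- leaves-dominate forbids enlarging the leaf side of the star ⁅ z ⁆ ∪ L, apex-unique its centre side.
  record MaximalStar (z : Fin n) (L : Subset n) : Set where
    field
      leaves-adjacent    : AdjacentToAll z L
      leaves-independent : Independent L
      leaves-dominate    : DominatesNeighbourhood z L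
      apex-unique        : ∀ {w} → AdjacentToAll w L → InClosedN G z w
      nonempty           : Nonempty L

  record CompleteBipartite (X Y : Subset n) : Set where
    field
      independentˡ : Independent X
      independentʳ : Independent Y
      complete     : ∀ {p q} → p ∈ X → q ∈ Y → E p q

  swapCompleteBipartite : ∀ {X Y} → CompleteBipartite X Y → CompleteBipartite Y X
  swapCompleteBipartite cb = record
    { independentˡ = independentʳ ; independentʳ = independentˡ
    ; complete = λ p∈Y q∈X → E-sym (complete q∈X p∈Y) }
    where open CompleteBipartite cb

  maximalStar-saturated : ∀ {z L X Y} → MaximalStar z L → CompleteBipartite X Y →
    (∀ {k} → k ∈ star z L → k ∈ X ⊎ k ∈ Y) → z ∈ X →
    ∀ {w} → w ∈ X ⊎ w ∈ Y → w ∈ star z L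
  maximalStar-saturated {z} {L} {X} {Y} ms cb covered z∈X = absorb
    where
      open MaximalStar ms
      open CompleteBipartite cb
      leaf∈Y : ∀ {k} → k ∈ L → k ∈ Y
      leaf∈Y k∈L with covered (leaf∈star z k∈L)
      ... | inj₁ k∈X = ⊥-elim (independentˡ z∈X k∈X (leaves-adjacent k∈L))
      ... | inj₂ k∈Y = k∈Y
      absorb : ∀ {w} → w ∈ X ⊎ w ∈ Y → w ∈ star z L
      absorb (inj₁ w∈X) with apex-unique (λ k∈L → complete w∈X (leaf∈Y k∈L))
      ... | inj₁ refl = centre∈star z L
      ... | inj₂ zw   = ⊥-elim (independentˡ z∈X w∈X zw)
      absorb (inj₂ w∈Y) with leaves-dominate (complete z∈X w∈Y)
      ... | inj₁ w∈L           = leaf∈star z w∈L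
      ... | inj₂ (j , j∈L , wj) = ⊥-elim (independentʳ w∈Y (leaf∈Y j∈L) wj)

  maximalStar⇒biclique : ∀ {z L} → MaximalStar z L → IsBiclique G (star z L)
  maximalStar⇒biclique {z} {L} ms =
    (⁅ z ⁆ , L , (λ _ → ∪⇔⊎) , centre∉L , (z , x∈⁅x⁆ z) , nonempty ,
     (λ _ _ → singleton-independent) , (λ _ _ → leaves-independent) ,
     (λ { p q p∈z q∈L → subst (λ c → E c q) (sym (x∈⁅y⁆⇒x≡y z p∈z)) (leaves-adjacent q∈L) })) ,
    maximal
    where
      open MaximalStar ms
      centre∉L : ∀ i → i ∈ ⁅ z ⁆ → i ∉ L
      centre∉L i i∈z i∈L with x∈⁅y⁆⇒x≡y z i∈z
      ... | refl = E-irr (leaves-adjacent i∈L)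
      maximal : ∀ S' → star z L ⊆ S' → IsInducedCompleteBipartite G S' → S' ⊆ star z L
      maximal S' sub (A , B , parts , _ , _ , _ , indA , indB , cAB) {w} w∈S' =
        orient (side (sub (centre∈star z L))) (side w∈S')
        where
          cb : CompleteBipartite A B
          cb = record { independentˡ = indA _ _ ; independentʳ = indB _ _ ; complete = cAB _ _ }
          side : ∀ {k} → k ∈ S' → k ∈ A ⊎ k ∈ B
          side {k} = Equivalence.to (parts k)
          orient : z ∈ A ⊎ z ∈ B → w ∈ A ⊎ w ∈ B → w ∈ star z L
          orient (inj₁ z∈A) w∈ = maximalStar-saturated ms cb (λ k∈ → side (sub k∈)) z∈A w∈
          orient (inj₂ z∈B) w∈ =
            maximalStar-saturated ms (swapCompleteBipartite cb) (λ k∈ → ⊎-swap (side (sub k∈))) z∈B (⊎-swap w∈)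

  trueTwins⇒maximalStar : ∀ {p q} → TrueTwins G p q → MaximalStar p ⁅ q ⁆
  trueTwins⇒maximalStar {p} {q} twins@(_ , closedN-equal) = record
    { leaves-adjacent    = λ k∈ → subst (E p) (sym (x∈⁅y⁆⇒x≡y q k∈)) (trueTwins⇒adjacent twins)
    ; leaves-independent = singleton-independent
    ; leaves-dominate    = dominate
    ; apex-unique        = λ wq → Equivalence.from (closedN-equal _) (inj₂ (E-sym (wq (x∈⁅x⁆ q))))
    ; nonempty           = q , x∈⁅x⁆ q
    }
    where
      dominate : DominatesNeighbourhood p ⁅ q ⁆
      dominate {w} pw with Equivalence.to (closedN-equal w) (inj₂ pw)
      ... | inj₁ refl = inj₁ (x∈⁅x⁆ q)
      ... | inj₂ qw   = inj₂ (q , x∈⁅x⁆ q , E-sym qw)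

  twoLeaves⇒apex-unique : ¬ HasInducedC4 G → ∀ {z L} → AdjacentToAll z L → Independent L →
    HasTwoElements L → ∀ {w} → AdjacentToAll w L → InClosedN G z w
  twoLeaves⇒apex-unique noC4 {z} adj ind (a , b , a∈ , b∈ , a≢b) {w} wL with w ≟ z
  ... | yes w≡z = inj₁ w≡z
  ... | no  w≢z = inj₂ (common-neighbours-adjacent noC4 a≢b (ind a∈ b∈)
                          (adj a∈) (adj b∈) (wL a∈) (wL b∈) (λ z≡w → w≢z (sym z≡w)))

  -- The far neighbour forces the maximal extension of S to have two leaves.
  record StarSeed (z : Fin n) (S : Subset n) : Set where
    field
      independentNeighbours : IndependentNeighbours z S
      inner          : Fin n
      inner∈         : inner ∈ S
      far-neighbour  : ∃[ y ] (E z y × ¬ InClosedN G inner y)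

  seed⇒maximalStar : ¬ HasInducedC4 G → ∀ {z S} → StarSeed z S →
    MaximalStar z (maximalExtension z S) × HasTwoElements (maximalExtension z S)
  seed⇒maximalStar noC4 {z} {S} seed = maximal , twoLeaves
    where
      open StarSeed seed
      leaves : IndependentNeighbours z (maximalExtension z S)
      leaves = extendByAll-independentNeighbours z (allFin n) S independentNeighbours
      inner∈L : inner ∈ maximalExtension z S
      inner∈L = ⊆-extendByAll z (allFin n) S inner∈
      twoLeaves : HasTwoElements (maximalExtension z S)
      twoLeaves with far-neighbour
      ... | y , zy , y-far with maximalExtension-dominates z S zy
      ...   | inj₁ y∈L           = inner , y , inner∈L , y∈L , λ i≡y → y-far (inj₁ (sym i≡y))
      ...   | inj₂ (j , j∈L , yj) = inner , j , inner∈L , j∈L , λ { refl → y-far (inj₂ (E-sym yj)) }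
      maximal : MaximalStar z (maximalExtension z S)
      maximal = record
        { leaves-adjacent    = proj₁ leaves
        ; leaves-independent = proj₂ leaves
        ; leaves-dominate    = maximalExtension-dominates z S
        ; apex-unique        = twoLeaves⇒apex-unique noC4 (proj₁ leaves) (proj₂ leaves) twoLeaves
        ; nonempty           = inner , inner∈L
        }

  star-centre-unique : ∀ {z z' L L'} → AdjacentToAll z L → HasTwoElements L → Independent L' →
    star z L ⊆ star z' L' → z ≡ z'
  star-centre-unique {z} {z'} {L} {L'} adj (a , b , a∈ , b∈ , a≢b) ind' sub
    with ∈-star⁻ z' L' (sub (centre∈star z L))
  ... | inj₁ z≡z' = z≡z'
  ... | inj₂ z∈L' = ⊥-elim (a≢b (trans (leaf≡centre a∈) (sym (leaf≡centre b∈))))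
    where
      leaf≡centre : ∀ {k} → k ∈ L → k ≡ z'
      leaf≡centre k∈ with ∈-star⁻ z' L' (sub (leaf∈star z k∈))
      ... | inj₁ k≡z' = k≡z'
      ... | inj₂ k∈L' = ⊥-elim (ind' z∈L' k∈L' (adj k∈))

  star⊈edge : ∀ {z L p q} → AdjacentToAll z L → HasTwoElements L → ¬ (star z L ⊆ edge (p , q))
  star⊈edge {z} {L} {p} {q} adj (a , b , a∈ , b∈ , a≢b) sub =
    three-distinct-in-pair (adjacent⇒≢ (adj a∈)) (adjacent⇒≢ (adj b∈)) a≢b
      (in-edge (centre∈star z L)) (in-edge (leaf∈star z a∈)) (in-edge (leaf∈star z b∈))
    where
      in-edge : ∀ {k} → k ∈ star z L → k ≡ p ⊎ k ≡ q
      in-edge k∈ = ∈-edge⁻ p q (sub k∈)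

  star-leaves-nonadjacent : ∀ {z z' L L' x y} → AdjacentToAll z L → Independent L' → z ≡ z' →
    star z L ⊆ star z' L' → x ∈ L → y ∈ L' → ¬ E x y
  star-leaves-nonadjacent {z} {L' = L'} adj ind' refl sub x∈ y∈ with ∈-star⁻ z L' (sub (leaf∈star z x∈))
  ... | inj₁ refl = ⊥-elim (E-irr (adj x∈))
  ... | inj₂ x∈L' = ind' x∈L' y∈

  edge⊆edge⇒sameEdge : ∀ {p q p' q'} → p ≢ q → edge (p , q) ⊆ edge (p' , q') → SameEdge G (p , q) (p' , q')
  edge⊆edge⇒sameEdge {p} {q} {p'} {q'} p≢q sub
    with ∈-edge⁻ p' q' (sub (centre∈star p ⁅ q ⁆)) | ∈-edge⁻ p' q' (sub (leaf∈star p (x∈⁅x⁆ q)))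
  ... | inj₁ p≡p' | inj₂ q≡q' = inj₁ (p≡p' , q≡q')
  ... | inj₂ p≡q' | inj₁ q≡p' = inj₂ (p≡q' , q≡p')
  ... | inj₁ p≡p' | inj₁ q≡p' = ⊥-elim (p≢q (trans p≡p' (sym q≡p')))
  ... | inj₂ p≡q' | inj₂ q≡q' = ⊥-elim (p≢q (trans p≡q' (sym q≡q')))

module Construction {n : ℕ} (G : Graph n) (noC4 : ¬ HasInducedC4 G) (connected : Connected G)
  (f : Fin n → Fin n × Fin n) (assignment : IsAssignment G f) (good : IsGood G f)
  {t : Fin n} (t-nonSimplicial : ¬ Simplicial G t) where
  open Graph G

  V V' : Fin n → Fin n
  V  u = proj₁ (f u)
  V' u = proj₂ (f u)

  module _ {u : Fin n} (al : Alone G u) where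

    alone-V : E u (V u)
    alone-V = proj₁ (assignment u al)

    alone-V' : E u (V' u)
    alone-V' = proj₁ (proj₂ (assignment u al))

    alone-VV' : E (V u) (V' u)
    alone-VV' = proj₁ (proj₂ (proj₂ (assignment u al)))

  simplicial⇒nonSimplicialNeighbour : ∀ {u} → Simplicial G u → ∃[ z ] (E u z × ¬ Simplicial G z)
  simplicial⇒nonSimplicialNeighbour {u} su with any? (λ z → E-dec u z ×-dec ¬? (simplicial? G z))
  ... | yes found = found
  ... | no none   = ⊥-elim (t-nonSimplicial (simplicial-in-N[u] (neighbourhood-spans G connected nbrs t)))
    where
      nbrs : ∀ {w} → E u w → Simplicial G w
      nbrs {w} uw = decidable-stable (simplicial? G w) (λ ns → none (w , uw , ns))
      simplicial-in-N[u] : ∀ {w} → InClosedN G u w → Simplicial G w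
      simplicial-in-N[u] (inj₁ refl) = su
      simplicial-in-N[u] (inj₂ uw)   = nbrs uw

  AdjacentRepresentative : Fin n → Fin n → Set
  AdjacentRepresentative z x = E z x × Representative G x

  adjacentRepresentative? : ∀ z → Decidable (AdjacentRepresentative z)
  adjacentRepresentative? z x = E-dec z x ×-dec representative? G x

  adjacentRepresentatives : Fin n → Subset n
  adjacentRepresentatives z = toSubset (adjacentRepresentative? z)

  adjacentRepresentatives-independentNeighbours : ∀ z → IndependentNeighbours G z (adjacentRepresentatives z)
  adjacentRepresentatives-independentNeighbours z =
    toSubset-independentNeighbours G (adjacentRepresentative? z) proj₁
      (λ (_ , rk) (_ , rl) → representatives-nonadjacent G rk rl)

  nonSimplicialSeed : ∀ {u} → ¬ Simplicial G u →
    ∃[ S ] (StarSeed G u S × adjacentRepresentatives u ⊆ S)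
  nonSimplicialSeed {u} ns with any? (adjacentRepresentative? u)
  ... | yes (x , ux , rx) = adjacentRepresentatives u , seed , ⊆-refl
    where
      seed : StarSeed G u (adjacentRepresentatives u)
      seed = record
        { independentNeighbours = adjacentRepresentatives-independentNeighbours u
        ; inner = x ; inner∈ = ∈-toSubset⁺ (adjacentRepresentative? u) (ux , rx)
        ; far-neighbour = ¬dominated⇒private-neighbour G ux (λ dom → ns (dominated⇒simplicial G dom (proj₁ rx))) }
  ... | no none with nonSimplicial⇒nonadjacent-neighbours G ns
  ...   | a , b , ua , ub , b-far =
    ⁅ a ⁆ , seed , λ x∈ → ⊥-elim (none (_ , ∈-toSubset⁻ (adjacentRepresentative? u) x∈))
    where
      seed : StarSeed G u ⁅ a ⁆
      seed = record
        { independentNeighbours = (λ k∈ → subst (E u) (sym (x∈⁅y⁆⇒x≡y a k∈)) ua) , singleton-independent G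
        ; inner = a ; inner∈ = x∈⁅x⁆ a
        ; far-neighbour = b , ub , b-far }

  AloneSeedMember : Fin n → Fin n → Set
  AloneSeedMember u k = k ≡ V' u ⊎ (AdjacentRepresentative (V u) k × ¬ E k (V' u))

  aloneSeedMember? : ∀ u → Decidable (AloneSeedMember u)
  aloneSeedMember? u k = (k ≟ V' u) ⊎-dec (adjacentRepresentative? (V u) k ×-dec ¬? (E-dec k (V' u)))

  aloneSeed : Fin n → Subset n
  aloneSeed u = toSubset (aloneSeedMember? u)

  aloneSeed-starSeed : ∀ {u} → Alone G u → ¬ DominatedBy G (V u) (V' u) → StarSeed G (V u) (aloneSeed u)
  aloneSeed-starSeed {u} al nd = record
    { independentNeighbours = toSubset-independentNeighbours G (aloneSeedMember? u) adjacent independent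
    ; inner = V' u ; inner∈ = ∈-toSubset⁺ (aloneSeedMember? u) (inj₁ refl)
    ; far-neighbour = ¬dominated⇒private-neighbour G (alone-VV' al) nd }
    where
      adjacent : ∀ {k} → AloneSeedMember u k → E (V u) k
      adjacent (inj₁ refl)          = alone-VV' al
      adjacent (inj₂ ((vk , _) , _)) = vk
      independent : ∀ {k l} → AloneSeedMember u k → AloneSeedMember u l → ¬ E k l
      independent (inj₁ refl)            (inj₁ refl)            = E-irr
      independent (inj₁ refl)            (inj₂ (_ , far))       = λ e → far (E-sym e)
      independent (inj₂ (_ , far))       (inj₁ refl)            = far
      independent (inj₂ ((_ , rk) , _)) (inj₂ ((_ , rl) , _)) = representatives-nonadjacent G rk rl

  SimplicialSeedMember : Fin n → Fin n → Fin n → Fin n → Set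
  SimplicialSeedMember u s z k = k ≡ s ⊎ (AdjacentRepresentative z k × k ≢ u)

  simplicialSeedMember? : ∀ u s z → Decidable (SimplicialSeedMember u s z)
  simplicialSeedMember? u s z k = (k ≟ s) ⊎-dec (adjacentRepresentative? z k ×-dec ¬? (k ≟ u))

  simplicialSeed : Fin n → Fin n → Fin n → Subset n
  simplicialSeed u s z = toSubset (simplicialSeedMember? u s z)

  simplicialSeed-starSeed : ∀ {u s z} → Representative G u → E u s → Simplicial G s → E u z → ¬ Simplicial G z →
    StarSeed G z (simplicialSeed u s z)
  simplicialSeed-starSeed {u} {s} {z} ru us ss uz nsz = record
    { independentNeighbours = toSubset-independentNeighbours G (simplicialSeedMember? u s z) adjacent independent
    ; inner = s ; inner∈ = ∈-toSubset⁺ (simplicialSeedMember? u s z) (inj₁ refl)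
    ; far-neighbour = ¬dominated⇒private-neighbour G zs (λ dom → nsz (dominated⇒simplicial G dom ss)) }
    where
      zs : E z s
      zs = simplicial-adjacent G (proj₁ ru) uz us λ { refl → nsz ss }
      adjacent : ∀ {k} → SimplicialSeedMember u s z k → E z k
      adjacent (inj₁ refl)          = zs
      adjacent (inj₂ ((zk , _) , _)) = zk
      s-far : ∀ {r} → Representative G r → r ≢ u → ¬ E s r
      s-far rr r≢u sr = representatives-nonadjacent G ru rr
        (simplicial-adjacent G ss (E-sym us) sr (λ u≡r → r≢u (sym u≡r)))
      independent : ∀ {k l} → SimplicialSeedMember u s z k → SimplicialSeedMember u s z l → ¬ E k l
      independent (inj₁ refl)              (inj₁ refl)              = E-irr
      independent (inj₁ refl)              (inj₂ ((_ , rl) , l≢u)) = s-far rl l≢u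
      independent (inj₂ ((_ , rk) , k≢u)) (inj₁ refl)              = λ ks → s-far rk k≢u (E-sym ks)
      independent (inj₂ ((_ , rk) , _))   (inj₂ ((_ , rl) , _))   = representatives-nonadjacent G rk rl

  data StarKind (u : Fin n) : Set where
    nonSimplicial  : ¬ Simplicial G u → StarKind u
    aloneStar      : Alone G u → ¬ DominatedBy G (V u) (V' u) → StarKind u
    simplicialStar : Representative G u → (s z : Fin n) → E u s → Simplicial G s →
                     E u z → ¬ Simplicial G z → StarKind u

  data EdgeKind (u : Fin n) : Set where
    aloneEdge      : Alone G u → TrueTwins G (V u) (V' u) → EdgeKind u
    simplicialEdge : (w : Fin n) → Simplicial G u → E u w → Simplicial G w → w < u → EdgeKind u

  Kind : Fin n → Set
  Kind u = StarKind u ⊎ EdgeKind u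

  centre : ∀ {u} → StarKind u → Fin n
  centre {u} (nonSimplicial _)              = u
  centre {u} (aloneStar _ _)                = V u
  centre     (simplicialStar _ _ z _ _ _ _) = z

  seed : ∀ {u} → StarKind u → Subset n
  seed       (nonSimplicial ns)             = proj₁ (nonSimplicialSeed ns)
  seed {u}   (aloneStar _ _)                = aloneSeed u
  seed {u}   (simplicialStar _ s z _ _ _ _) = simplicialSeed u s z

  starSeed : ∀ {u} (k : StarKind u) → StarSeed G (centre k) (seed k)
  starSeed (nonSimplicial ns)                   = proj₁ (proj₂ (nonSimplicialSeed ns))
  starSeed (aloneStar al nd)                    = aloneSeed-starSeed al nd
  starSeed (simplicialStar ru s z us ss uz nsz) = simplicialSeed-starSeed ru us ss uz nsz

  leaves : ∀ {u} → StarKind u → Subset n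
  leaves k = maximalExtension G (centre k) (seed k)

  seed⊆leaves : ∀ {u} (k : StarKind u) → seed k ⊆ leaves k
  seed⊆leaves k = ⊆-extendByAll G (centre k) (allFin n) (seed k)

  starKind-maximalStar : ∀ {u} (k : StarKind u) → MaximalStar G (centre k) (leaves k) × HasTwoElements (leaves k)
  starKind-maximalStar k = seed⇒maximalStar G noC4 (starSeed k)

  starKind-leaves-adjacent : ∀ {u} (k : StarKind u) → AdjacentToAll G (centre k) (leaves k)
  starKind-leaves-adjacent k = MaximalStar.leaves-adjacent (proj₁ (starKind-maximalStar k))

  starKind-leaves-independent : ∀ {u} (k : StarKind u) → Independent G (leaves k)
  starKind-leaves-independent k = MaximalStar.leaves-independent (proj₁ (starKind-maximalStar k))

  starKind-twoLeaves : ∀ {u} (k : StarKind u) → HasTwoElements (leaves k)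
  starKind-twoLeaves k = proj₂ (starKind-maximalStar k)

  starOf : ∀ {u} → StarKind u → Subset n
  starOf k = star G (centre k) (leaves k)

  endpoints : ∀ {u} → EdgeKind u → Fin n × Fin n
  endpoints {u} (aloneEdge _ _)             = f u
  endpoints {u} (simplicialEdge w _ _ _ _) = u , w

  endpoints-trueTwins : ∀ {u} (k : EdgeKind u) → TrueTwins G (proj₁ (endpoints k)) (proj₂ (endpoints k))
  endpoints-trueTwins (aloneEdge _ twins)           = twins
  endpoints-trueTwins (simplicialEdge _ su uw sw _) = adjacent-simplicial⇒trueTwins G su sw uw

  biclique : ∀ {u} → Kind u → Subset n
  biclique (inj₁ k) = starOf k
  biclique (inj₂ k) = edge G (endpoints k)

  biclique-isBiclique : ∀ {u} (k : Kind u) → IsBiclique G (biclique k)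
  biclique-isBiclique (inj₁ k) = maximalStar⇒biclique G (proj₁ (starKind-maximalStar k))
  biclique-isBiclique (inj₂ k) = maximalStar⇒biclique G (trueTwins⇒maximalStar G (endpoints-trueTwins k))

  kind : ∀ u → Kind u
  kind u with simplicial? G u
  ... | no ns = inj₁ (nonSimplicial ns)
  ... | yes su with any? (λ w → E-dec u w ×-dec simplicial? G w)
  ...   | no none = alone (su , λ w uw sw → none (w , uw , sw))
    where
      alone : Alone G u → Kind u
      alone al with proj₂ (proj₂ (proj₂ (assignment u al)))
      ... | inj₁ nd    = inj₁ (aloneStar al nd)
      ... | inj₂ twins = inj₂ (aloneEdge al twins)
  ...   | yes (s , us , ss) with hasSmallerSimplicialNeighbour? G u
  ...     | yes (w , uw , sw , w<u) = inj₂ (simplicialEdge w su uw sw w<u)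
  ...     | no minimal with simplicial⇒nonSimplicialNeighbour su
  ...       | z , uz , nsz = inj₁ (simplicialStar (su , minimal) s z us ss uz nsz)

  -- Which representative neighbours r of the centre are guaranteed to be leaves.
  Absorbs : ∀ {u} → StarKind u → Fin n → Set
  Absorbs     (nonSimplicial _)               r = ⊤
  Absorbs {u} (aloneStar _ _)                 r = ¬ E r (V' u)
  Absorbs {u} (simplicialStar _ _ _ _ _ _ _)  r = r ≢ u

  absorbs : ∀ {u r} (k : StarKind u) → E (centre k) r → Representative G r → Absorbs k r → r ∈ leaves k
  absorbs k@(nonSimplicial ns) cr rr _ =
    seed⊆leaves k (proj₂ (proj₂ (nonSimplicialSeed ns)) (∈-toSubset⁺ (adjacentRepresentative? _) (cr , rr)))
  absorbs k@(aloneStar _ _) cr rr far =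
    seed⊆leaves k (∈-toSubset⁺ (aloneSeedMember? _) (inj₂ ((cr , rr) , far)))
  absorbs k@(simplicialStar _ _ _ _ _ _ _) cr rr r≢u =
    seed⊆leaves k (∈-toSubset⁺ (simplicialSeedMember? _ _ _) (inj₂ ((cr , rr) , r≢u)))

  record Owned {u : Fin n} (k : StarKind u) : Set where
    field
      owner-representative : Representative G u
      centre-owner         : E (centre k) u
      ownerLeaf            : Fin n
      ownerLeaf∈           : ownerLeaf ∈ leaves k
      owner-ownerLeaf      : E u ownerLeaf

  aloneStar-owned : ∀ {u} (al : Alone G u) (nd : ¬ DominatedBy G (V u) (V' u)) → Owned (aloneStar al nd)
  aloneStar-owned al nd = record
    { owner-representative = alone⇒representative G al
    ; centre-owner = E-sym (alone-V al)
    ; ownerLeaf = _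
    ; ownerLeaf∈ = seed⊆leaves (aloneStar al nd) (∈-toSubset⁺ (aloneSeedMember? _) (inj₁ refl))
    ; owner-ownerLeaf = alone-V' al }

  simplicialStar-owned : ∀ {u s z} (ru : Representative G u) (us : E u s) (ss : Simplicial G s)
    (uz : E u z) (nsz : ¬ Simplicial G z) → Owned (simplicialStar ru s z us ss uz nsz)
  simplicialStar-owned ru us ss uz nsz = record
    { owner-representative = ru
    ; centre-owner = E-sym uz
    ; ownerLeaf = _
    ; ownerLeaf∈ = seed⊆leaves (simplicialStar ru _ _ us ss uz nsz) (∈-toSubset⁺ (simplicialSeedMember? _ _ _) (inj₁ refl))
    ; owner-ownerLeaf = us }

  stars-leaves-nonadjacent : ∀ {u u' x y} (k : StarKind u) (k' : StarKind u') → centre k ≡ centre k' →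
    starOf k ⊆ starOf k' → x ∈ leaves k → y ∈ leaves k' → ¬ E x y
  stars-leaves-nonadjacent k k' =
    star-leaves-nonadjacent G (starKind-leaves-adjacent k) (starKind-leaves-independent k')

  owned-clash : ∀ {u u'} (k : StarKind u) (k' : StarKind u') → Owned k' → centre k ≡ centre k' →
    starOf k ⊆ starOf k' → Absorbs k u' → ⊥
  owned-clash k k' owned c≡c' sub absorbed =
    stars-leaves-nonadjacent k k' c≡c' sub
      (absorbs k (subst (λ c → E c _) (sym c≡c') centre-owner) owner-representative absorbed)
      ownerLeaf∈ owner-ownerLeaf
    where open Owned owned

  aloneStars-clash : ∀ {u u'} → u ≢ u' → (al : Alone G u) (nd : ¬ DominatedBy G (V u) (V' u))
    (al' : Alone G u') (nd' : ¬ DominatedBy G (V u') (V' u')) → V u ≡ V u' →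
    starOf (aloneStar al nd) ⊆ starOf (aloneStar al' nd') → ⊥
  aloneStars-clash {u} {u'} u≢u' al nd al' nd' c≡c' sub with V' u ≟ V' u'
  ... | yes same = proj₂ (good u u' al al' u≢u' (inj₁ (c≡c' , same))) c≡c'
  ... | no differ with E-dec u' (V' u)
  ...   | no far = owned-clash (aloneStar al nd) (aloneStar al' nd') (aloneStar-owned al' nd') c≡c' sub far
  ...   | yes near =
    stars-leaves-nonadjacent (aloneStar al nd) (aloneStar al' nd') c≡c' sub
      (Owned.ownerLeaf∈ (aloneStar-owned al nd)) (Owned.ownerLeaf∈ (aloneStar-owned al' nd'))
      (simplicial-adjacent G (proj₁ al') near (alone-V' al') differ)

  sameCentre-clash : ∀ {u u'} → u ≢ u' → (k : StarKind u) (k' : StarKind u') → centre k ≡ centre k' →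
    starOf k ⊆ starOf k' → starOf k' ⊆ starOf k → ⊥
  sameCentre-clash u≢u' (nonSimplicial _) (nonSimplicial _) c≡c' _ _ = u≢u' c≡c'
  sameCentre-clash _ k@(nonSimplicial _) k'@(aloneStar al' nd') c≡c' sub _ =
    owned-clash k k' (aloneStar-owned al' nd') c≡c' sub tt
  sameCentre-clash _ k@(nonSimplicial _) k'@(simplicialStar ru' _ _ us' ss' uz' nsz') c≡c' sub _ =
    owned-clash k k' (simplicialStar-owned ru' us' ss' uz' nsz') c≡c' sub tt
  sameCentre-clash _ k@(aloneStar al nd) k'@(nonSimplicial _) c≡c' _ sup =
    owned-clash k' k (aloneStar-owned al nd) (sym c≡c') sup tt
  sameCentre-clash _ k@(simplicialStar ru _ _ us ss uz nsz) k'@(nonSimplicial _) c≡c' _ sup =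
    owned-clash k' k (simplicialStar-owned ru us ss uz nsz) (sym c≡c') sup tt
  sameCentre-clash u≢u' (aloneStar al nd) (aloneStar al' nd') c≡c' sub _ =
    aloneStars-clash u≢u' al nd al' nd' c≡c' sub
  sameCentre-clash u≢u' k@(aloneStar al nd) k'@(simplicialStar _ _ _ _ _ _ _) c≡c' _ sup =
    owned-clash k' k (aloneStar-owned al nd) (sym c≡c') sup u≢u'
  sameCentre-clash u≢u' k@(simplicialStar _ _ _ _ _ _ _) k'@(aloneStar al' nd') c≡c' sub _ =
    owned-clash k k' (aloneStar-owned al' nd') c≡c' sub (λ u'≡u → u≢u' (sym u'≡u))
  sameCentre-clash u≢u' k@(simplicialStar _ _ _ _ _ _ _) k'@(simplicialStar ru' _ _ us' ss' uz' nsz') c≡c' sub _ =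
    owned-clash k k' (simplicialStar-owned ru' us' ss' uz' nsz') c≡c' sub (λ u'≡u → u≢u' (sym u'≡u))

  starKinds-distinct : ∀ {u u'} → u ≢ u' → (k : StarKind u) (k' : StarKind u') → starOf k ≡ starOf k' → ⊥
  starKinds-distinct u≢u' k k' eq = sameCentre-clash u≢u' k k' c≡c' (⊆-reflexive eq) (⊆-reflexive (sym eq))
    where
      c≡c' : centre k ≡ centre k'
      c≡c' = star-centre-unique G (starKind-leaves-adjacent k) (starKind-twoLeaves k)
               (starKind-leaves-independent k') (⊆-reflexive eq)

  aloneEdge-avoids-simplicial : ∀ {u v w} → Alone G u → Simplicial G v → ¬ (edge G (v , w) ⊆ edge G (f u))
  aloneEdge-avoids-simplicial {u} {v} al sv sub with ∈-edge⁻ G (V u) (V' u) (sub (centre∈star G v _))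
  ... | inj₁ refl = proj₂ al _ (alone-V al) sv
  ... | inj₂ refl = proj₂ al _ (alone-V' al) sv

  edgeKinds-distinct : ∀ {u u'} → u ≢ u' → (k : EdgeKind u) (k' : EdgeKind u') →
    edge G (endpoints k) ≡ edge G (endpoints k') → ⊥
  edgeKinds-distinct u≢u' (aloneEdge al twins) (aloneEdge al' _) eq =
    proj₁ (good _ _ al al' u≢u' (edge⊆edge⇒sameEdge G (proj₁ twins) (⊆-reflexive eq))) twins
  edgeKinds-distinct _ (aloneEdge al _) (simplicialEdge _ su' _ _ _) eq =
    aloneEdge-avoids-simplicial al su' (⊆-reflexive (sym eq))
  edgeKinds-distinct _ (simplicialEdge _ su _ _ _) (aloneEdge al' _) eq =
    aloneEdge-avoids-simplicial al' su (⊆-reflexive eq)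
  edgeKinds-distinct u≢u' (simplicialEdge _ _ uw _ w<u) (simplicialEdge _ _ _ _ w'<u') eq
    with edge⊆edge⇒sameEdge G (adjacent⇒≢ G uw) (⊆-reflexive eq)
  ... | inj₁ (u≡u' , _)  = u≢u' u≡u'
  ... | inj₂ (refl , refl) = <-asym w<u w'<u'

  kinds-distinct : ∀ {u u'} → u ≢ u' → (k : Kind u) (k' : Kind u') → biclique k ≡ biclique k' → ⊥
  kinds-distinct u≢u' (inj₁ k) (inj₁ k') eq = starKinds-distinct u≢u' k k' eq
  kinds-distinct u≢u' (inj₂ k) (inj₂ k') eq = edgeKinds-distinct u≢u' k k' eq
  kinds-distinct _ (inj₁ k) (inj₂ _) eq =
    star⊈edge G (starKind-leaves-adjacent k) (starKind-twoLeaves k) (⊆-reflexive eq)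
  kinds-distinct _ (inj₂ _) (inj₁ k') eq =
    star⊈edge G (starKind-leaves-adjacent k') (starKind-twoLeaves k') (⊆-reflexive (sym eq))

  atLeast-n-bicliques : AtLeastBicliques G n
  atLeast-n-bicliques = (λ u → biclique (kind u)) , (λ u → biclique-isBiclique (kind u)) , injective
    where
      injective : ∀ i j → biclique (kind i) ≡ biclique (kind j) → i ≡ j
      injective i j eq with i ≟ j
      ... | yes i≡j = i≡j
      ... | no  i≢j = ⊥-elim (kinds-distinct i≢j (kind i) (kind j) eq)

module CompleteGraph {m : ℕ} (G : Graph (3 + m)) (connected : Connected G)
  (all-simplicial : ∀ v → Simplicial G v) where

  distinct⇒trueTwins : ∀ {p q} → p ≢ q → TrueTwins G p q
  distinct⇒trueTwins {p} {q} p≢q with neighbourhood-spans G connected (λ {w} _ → all-simplicial w) q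
  ... | inj₁ q≡p = ⊥-elim (p≢q (sym q≡p))
  ... | inj₂ pq  = adjacent-simplicial⇒trueTwins G (all-simplicial p) (all-simplicial q) pq

  edgeAt : Fin (3 + m) → Fin (3 + m) × Fin (3 + m)
  edgeAt zero    = suc zero , suc (suc zero)
  edgeAt (suc i) = zero , suc i

  edgeAt-distinct : ∀ i → proj₁ (edgeAt i) ≢ proj₂ (edgeAt i)
  edgeAt-distinct zero    ()
  edgeAt-distinct (suc i) ()

  edgeAt-injective : ∀ i j → SameEdge G (edgeAt i) (edgeAt j) → i ≡ j
  edgeAt-injective zero    zero    _                  = refl
  edgeAt-injective zero    (suc j) (inj₁ (() , _))
  edgeAt-injective zero    (suc j) (inj₂ (_ , ()))
  edgeAt-injective (suc i) zero    (inj₁ (() , _))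
  edgeAt-injective (suc i) zero    (inj₂ (() , _))
  edgeAt-injective (suc i) (suc j) (inj₁ (_ , i≡j)) = i≡j
  edgeAt-injective (suc i) (suc j) (inj₂ (() , _))

  atLeast-n-bicliques : AtLeastBicliques G (3 + m)
  atLeast-n-bicliques =
    (λ i → edge G (edgeAt i)) ,
    (λ i → maximalStar⇒biclique G (trueTwins⇒maximalStar G (distinct⇒trueTwins (edgeAt-distinct i)))) ,
    (λ i j eq → edgeAt-injective i j (edge⊆edge⇒sameEdge G (edgeAt-distinct i) (⊆-reflexive eq)))

lemma3p1 : (n : ℕ) → n ≥ 3 → (G : Graph n) → Connected G →
    ¬ HasInducedC4 G →
    (∀ u v → ¬ FalseTwins G u v) →
    (∀ v → degree G v ≢ 1) →
    HasGoodAssignment G →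
    AtLeastBicliques G n
lemma3p1 n (s≤s (s≤s (s≤s z≤n))) G connected noC4 _ _ (f , assignment , good)
  with any? (λ t → ¬? (simplicial? G t))
... | yes (t , t-nonSimplicial) =
  Construction.atLeast-n-bicliques G noC4 connected f assignment good t-nonSimplicial
... | no none =
  CompleteGraph.atLeast-n-bicliques G connected
    (λ t → decidable-stable (simplicial? G t) (λ ns → none (t , ns)))
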